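{- Let $\mathbf u$ be an infinite word over a finite alphabet whose language is closed under reversal and whose defect $D(\mathbf u)$ is finite. Let $q$ be a prefix of $\mathbf u$ with $D(q)=D(\mathbf u)$, and put $H=|q|+1$. Then $$\mathcal C_{\mathbf u}(H)-\mathcal P_{\mathbf u}(H)=2\,\#\{x\in\mathcal L(\mathbf u): x \text{ is a palindrome},\ |x|<H,\ x\notin\mathcal L(q)\}.$$
   Context: For a finite word $w=w_0\cdots w_{n-1}$ its reversal is $\overline{w}=w_{n-1}\cdots w_0$; $w$ is a palindrome if $w=\overline{w}$ (the empty word is a palindrome). $\mathcal L(v)$ denotes the set of factors of a (finite or infinite) word $v$, and $\mathcal L_n(v)$ those of length $n$. The language of $\mathbf u$ is closed under reversal if $w\in\mathcal L(\mathbf u)$ implies $\overline{w}\in\mathcal L(\mathbf u)$. The defect of a finite word $w$ is $D(w)=|w|+1-(\text{number of distinct palindromic factors of } w, \text{ including the empty word})$, and $D(\mathbf u)=\sup\{D(w): w \text{ a prefix of } \mathbf u\}$. $\mathcal C_{\mathbf u}(n)=\#\mathcal L_n(\mathbf u)$ and $\mathcal P_{\mathbf u}(n)$ is the number of palindromes in $\mathcal L_n(\mathbf u)$. -}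

module Defs where

open import Data.Nat using (ℕ; zero; suc; _+_; _∸_)
open import Data.Fin using (Fin)
import Data.Fin as Fin
open import Data.List using (List; []; _∷_; _++_; length; reverse; inits; tails; concatMap; filter; deduplicate)
open import Data.List.Properties using (≡-dec)
open import Data.List.Membership.Propositional using (_∈_)
open import Data.List.Relation.Unary.Unique.Propositional using (Unique)
open import Data.Product using (Σ; ∃; ∃₂; _×_)
open import Function.Bundles using (_⇔_)
open import Relation.Binary.PropositionalEquality using (_≡_)
open import Relation.Nullary using (Dec)

Word : ℕ → Set
Word k = List (Fin k)

InfWord : ℕ → Set
InfWord k = ℕ → Fin k

segment : ∀ {k} → InfWord k → ℕ → ℕ → Word k
segment u i zero = []
segment u i (suc n) = u i ∷ segment u (suc i) n

prefix : ∀ {k} → InfWord k → ℕ → Word k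
prefix u n = segment u 0 n

Factor : ∀ {k} → InfWord k → Word k → Set
Factor u w = ∃ λ i → segment u i (length w) ≡ w

FactorOf : ∀ {k} → Word k → Word k → Set
FactorOf w v = ∃₂ λ a b → a ++ w ++ b ≡ v

Palindrome : ∀ {k} → Word k → Set
Palindrome w = reverse w ≡ w

ClosedUnderReversal : ∀ {k} → InfWord k → Set
ClosedUnderReversal u = ∀ w → Factor u w → Factor u (reverse w)

_≟w_ : ∀ {k} (v w : Word k) → Dec (v ≡ w)
_≟w_ = ≡-dec Fin._≟_

palindrome? : ∀ {k} (w : Word k) → Dec (Palindrome w)
palindrome? w = reverse w ≟w w

allFactors : ∀ {k} → Word k → List (Word k)
allFactors v = concatMap inits (tails v)

-- number of distinct palindromic factors of v (empty word included)
numPal : ∀ {k} → Word k → ℕ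
numPal v = length (deduplicate _≟w_ (filter palindrome? (allFactors v)))

defect : ∀ {k} → Word k → ℕ
defect w = (length w + 1) ∸ numPal w

HasCard : ∀ {k} → (Word k → Set) → ℕ → Set
HasCard {k} P n = Σ (List (Word k)) λ xs → Unique xs × (∀ w → (w ∈ xs) ⇔ P w) × length xs ≡ n

module Submission where

-- Let H = N + 1, where the prefix of length N of u has maximal defect.  The factors of
-- length H split into palindromes, non-palindromes w whose first occurrence precedes
-- that of their reversal ("earlier"), and the remaining non-palindromes ("later").
-- Reversal is a bijection from the earlier onto the later windows, and taking the
-- longest palindromic suffix (lps) is a bijection from the earlier windows onto the
-- palindromes of length < H that are not factors of the prefix of length N.

open import Defs
open import Data.Nat using (ℕ; zero; suc; _+_; _*_; _∸_; _⊔_; _≤_; _<_; z≤n; s≤s; _<?_)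
open import Data.Nat.Properties
open import Data.Nat.Tactic.RingSolver using (solve-∀)
open import Data.List
  using (List; []; _∷_; _++_; _∷ʳ_; [_]; length; reverse; map; filter; inits; deduplicate; _∷ʳ′_; initLast)
open import Data.List.Properties
  using ( length-++; length-map; length-reverse; length-++-sucʳ; length-++-≤ˡ; length-++-≤ʳ
        ; ++-assoc; ++-identityʳ; ++-conicalʳ; ∷-injective; ∷ʳ-injectiveˡ
        ; reverse-++; reverse-involutive; reverse-injective; unfold-reverse )
open import Data.List.Reverse using (Reverse; []; _∶_∶ʳ_; reverseView)
open import Data.List.Membership.Propositional using (_∈_)
open import Data.List.Membership.Propositional.Properties
  using (∈-∃++; ∈-++⁺ˡ; ∈-++⁺ʳ; ∈-++⁻; ∈-map⁺; ∈-map⁻; ∈-filter⁺; ∈-filter⁻; ∈-deduplicate⁺; ∈-deduplicate⁻)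
open import Data.List.Relation.Binary.Subset.Propositional using (_⊆_)
open import Data.List.Relation.Unary.Any using (here; there)
import Data.List.Relation.Unary.All as All
open import Data.List.Relation.Unary.AllPairs using ([]; _∷_)
open import Data.List.Relation.Unary.Unique.Propositional using (Unique)
import Data.List.Relation.Unary.Unique.Propositional.Properties as Unique
import Data.List.Relation.Unary.Unique.DecPropositional.Properties as UniqueDec
open import Data.Product using (Σ; ∃; _×_; _,_; proj₁; proj₂)
import Data.Product as Product
open import Data.Sum using (_⊎_; inj₁; inj₂)
open import Data.Empty using (⊥-elim)
open import Function using (_∘_)
open import Function.Bundles using (_⇔_; mk⇔; Equivalence)
open import Relation.Nullary using (¬_; Dec; yes; no)
open import Relation.Nullary.Decidable using (¬?)
open import Relation.Binary.Definitions using (tri<; tri≈; tri>)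
open import Relation.Binary.PropositionalEquality hiding ([_])
open ≡-Reasoning
open Equivalence using (to; from)

unique-⊆⇒length-≤ : ∀ {A : Set} {xs ys : List A} → Unique xs → xs ⊆ ys → length xs ≤ length ys
unique-⊆⇒length-≤ [] _ = z≤n
unique-⊆⇒length-≤ {xs = x ∷ xs} (x∉xs ∷ xs-unique) xs⊆ys with ∈-∃++ (xs⊆ys (here refl))
... | ys₁ , ys₂ , refl =
  subst (suc (length xs) ≤_) (sym (length-++-sucʳ ys₁ x ys₂))
        (s≤s (unique-⊆⇒length-≤ xs-unique xs⊆ys₁ys₂))
  where
  xs⊆ys₁ys₂ : xs ⊆ ys₁ ++ ys₂
  xs⊆ys₁ys₂ {z} z∈xs with ∈-++⁻ ys₁ (xs⊆ys (there z∈xs))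
  ... | inj₁ z∈ys₁ = ∈-++⁺ˡ z∈ys₁
  ... | inj₂ (here refl) = ⊥-elim (All.lookup x∉xs z∈xs refl)
  ... | inj₂ (there z∈ys₂) = ∈-++⁺ʳ ys₁ z∈ys₂

same-members⇒same-length : ∀ {A : Set} {xs ys : List A} → Unique xs → Unique ys →
  xs ⊆ ys → ys ⊆ xs → length xs ≡ length ys
same-members⇒same-length xs-unique ys-unique xs⊆ys ys⊆xs =
  ≤-antisym (unique-⊆⇒length-≤ xs-unique xs⊆ys) (unique-⊆⇒length-≤ ys-unique ys⊆xs)

card-length : ∀ {k} {P : Word k → Set} {n : ℕ} {ys : List (Word k)} →
  HasCard P n → Unique ys → (∀ w → w ∈ ys ⇔ P w) → length ys ≡ n
card-length (xs , xs-unique , xs-enum , refl) ys-unique ys-enum =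
  same-members⇒same-length ys-unique xs-unique
    (λ {w} w∈ys → from (xs-enum w) (to (ys-enum w) w∈ys))
    (λ {w} w∈xs → from (ys-enum w) (to (xs-enum w) w∈xs))

map-unique : ∀ {A B : Set} (f : A → B) {xs : List A} → Unique xs →
  (∀ {x y} → x ∈ xs → y ∈ xs → f x ≡ f y → x ≡ y) → Unique (map f xs)
map-unique f [] _ = []
map-unique f {x ∷ xs} (x∉xs ∷ xs-unique) injective =
  All.tabulate fx∉ ∷ map-unique f xs-unique (λ x∈ y∈ → injective (there x∈) (there y∈))
  where
  fx∉ : ∀ {y} → y ∈ map f xs → f x ≢ y
  fx∉ y∈ fx≡y with ∈-map⁻ f y∈
  ... | z , z∈xs , refl = All.lookup x∉xs z∈xs (injective (here refl) (there z∈xs) fx≡y)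

length-filter-split : ∀ {A : Set} {P : A → Set} (P? : ∀ x → Dec (P x)) (xs : List A) →
  length xs ≡ length (filter P? xs) + length (filter (¬? ∘ P?) xs)
length-filter-split P? [] = refl
length-filter-split P? (x ∷ xs) with P? x
... | yes _ = cong suc (length-filter-split P? xs)
... | no _ = trans (cong suc (length-filter-split P? xs)) (sym (+-suc _ _))

-- The least j < n satisfying a decidable predicate (or n if there is none).
least : ∀ {P : ℕ → Set} → (∀ j → Dec (P j)) → ℕ → ℕ
least P? zero = zero
least P? (suc n) with P? 0
... | yes _ = zero
... | no _ = suc (least (P? ∘ suc) n)

least-sound : ∀ {P : ℕ → Set} (P? : ∀ j → Dec (P j)) n {j} → P j → j < n → P (least P? n)
least-sound P? (suc n) pj j<n with P? 0
... | yes p0 = p0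
least-sound P? (suc n) {zero} pj _ | no ¬p0 = ⊥-elim (¬p0 pj)
least-sound P? (suc n) {suc j} pj (s≤s j<n) | no _ = least-sound (P? ∘ suc) n pj j<n

least-minimal : ∀ {P : ℕ → Set} (P? : ∀ j → Dec (P j)) n {j} → P j → least P? n ≤ j
least-minimal P? zero _ = z≤n
least-minimal P? (suc n) pj with P? 0
... | yes _ = z≤n
least-minimal P? (suc n) {zero} pj | no ¬p0 = ⊥-elim (¬p0 pj)
least-minimal P? (suc n) {suc j} pj | no _ = s≤s (least-minimal (P? ∘ suc) n pj)

module _ {A : Set} where

  ++-cancel-length : ∀ (xs ys xs′ ys′ : List A) → xs ++ ys ≡ xs′ ++ ys′ →
    length xs ≡ length xs′ → xs ≡ xs′ × ys ≡ ys′
  ++-cancel-length [] ys [] ys′ e _ = refl , e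
  ++-cancel-length (x ∷ xs) ys (x′ ∷ xs′) ys′ e same-length with ∷-injective e
  ... | refl , e′ = Product.map₁ (cong (x ∷_)) (++-cancel-length xs ys xs′ ys′ e′ (suc-injective same-length))
  ++-cancel-length [] _ (_ ∷ _) _ _ ()
  ++-cancel-length (_ ∷ _) _ [] _ _ ()

  suffix-of-suffix : ∀ (a x b y : List A) → a ++ x ≡ b ++ y → length x ≤ length y →
    ∃ λ d → d ++ x ≡ y
  suffix-of-suffix a x [] y e _ = a , e
  suffix-of-suffix [] x (c ∷ b) y e x≤y =
    ⊥-elim (<⇒≱ (subst (length y <_) (cong length (sym e)) (s≤s (length-++-≤ʳ y {b}))) x≤y)
  suffix-of-suffix (c ∷ a) x (c′ ∷ b) y e x≤y = suffix-of-suffix a x b y (proj₂ (∷-injective e)) x≤y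

  drop-last : ∀ (a x b : List A) c′ w c → a ++ x ++ (b ∷ʳ c′) ≡ w ∷ʳ c → a ++ x ++ b ≡ w
  drop-last a x b c′ w c e = ∷ʳ-injectiveˡ (a ++ x ++ b) w (trans reassociate e)
    where
    reassociate : (a ++ x ++ b) ∷ʳ c′ ≡ a ++ x ++ (b ∷ʳ c′)
    reassociate = trans (++-assoc a (x ++ b) [ c′ ]) (cong (a ++_) (++-assoc x b [ c′ ]))

  ∈-inits⁺ : ∀ (x b w : List A) → x ++ b ≡ w → x ∈ inits w
  ∈-inits⁺ [] b w _ = here refl
  ∈-inits⁺ (c ∷ x) b (c′ ∷ w) e with ∷-injective e
  ... | refl , e′ = there (∈-map⁺ (c ∷_) (∈-inits⁺ x b w e′))

  ∈-inits⁻ : ∀ (x w : List A) → x ∈ inits w → ∃ λ b → x ++ b ≡ w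
  ∈-inits⁻ x w (here refl) = w , refl
  ∈-inits⁻ x (c ∷ w) (there x∈) with ∈-map⁻ (c ∷_) {xs = inits w} x∈
  ... | y , y∈ , refl = Product.map₂ (cong (c ∷_)) (∈-inits⁻ y w y∈)

module _ {k : ℕ} where

  ∈-allFactors⁺ : ∀ {x} (v : Word k) → FactorOf x v → x ∈ allFactors v
  ∈-allFactors⁺ [] ([] , b , e) = ∈-++⁺ˡ (∈-inits⁺ _ b [] e)
  ∈-allFactors⁺ (c ∷ v) ([] , b , e) = ∈-++⁺ˡ (∈-inits⁺ _ b (c ∷ v) e)
  ∈-allFactors⁺ (c ∷ v) (_ ∷ a , b , e) =
    ∈-++⁺ʳ (inits (c ∷ v)) (∈-allFactors⁺ v (a , b , proj₂ (∷-injective e)))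

  ∈-allFactors⁻ : ∀ {x} (v : Word k) → x ∈ allFactors v → FactorOf x v
  ∈-allFactors⁻ [] (here refl) = [] , [] , refl
  ∈-allFactors⁻ {x} (c ∷ v) x∈ with ∈-++⁻ (inits (c ∷ v)) x∈
  ... | inj₁ x∈inits = [] , ∈-inits⁻ x (c ∷ v) x∈inits
  ... | inj₂ x∈rest with ∈-allFactors⁻ v x∈rest
  ...   | a , b , e = c ∷ a , b , cong (c ∷_) e

  palFactors : Word k → List (Word k)
  palFactors v = deduplicate _≟w_ (filter palindrome? (allFactors v))

  ∈-palFactors : ∀ {x} v → Palindrome x → FactorOf x v → x ∈ palFactors v
  ∈-palFactors v pal factor = ∈-deduplicate⁺ _≟w_ (∈-filter⁺ palindrome? (∈-allFactors⁺ v factor) pal)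

  numPal-≤ : ∀ v (ys : List (Word k)) → (∀ x → Palindrome x → FactorOf x v → x ∈ ys) →
    numPal v ≤ length ys
  numPal-≤ v ys covers =
    unique-⊆⇒length-≤ (UniqueDec.deduplicate-! _≟w_ (filter palindrome? (allFactors v))) palFactors⊆ys
    where
    palFactors⊆ys : palFactors v ⊆ ys
    palFactors⊆ys {x} x∈ with ∈-filter⁻ palindrome? (∈-deduplicate⁻ _≟w_ _ x∈)
    ... | x∈factors , pal = covers x pal (∈-allFactors⁻ v x∈factors)

  nonpalindrome-reverse : ∀ {w : Word k} → ¬ Palindrome w → ¬ Palindrome (reverse w)
  nonpalindrome-reverse {w} nonpal pal = nonpal (sym (trans (sym (reverse-involutive w)) pal))

  lps : Word k → Word k
  lps [] = []
  lps (c ∷ w) with palindrome? (c ∷ w)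
  ... | yes _ = c ∷ w
  ... | no _ = lps w

  lps-palindrome : ∀ w → Palindrome (lps w)
  lps-palindrome [] = refl
  lps-palindrome (c ∷ w) with palindrome? (c ∷ w)
  ... | yes pal = pal
  ... | no _ = lps-palindrome w

  lps-suffix : ∀ w → ∃ λ a → a ++ lps w ≡ w
  lps-suffix [] = [] , refl
  lps-suffix (c ∷ w) with palindrome? (c ∷ w)
  ... | yes _ = [] , refl
  ... | no _ = Product.map (c ∷_) (cong (c ∷_)) (lps-suffix w)

  lps-longest : ∀ w a y → Palindrome y → a ++ y ≡ w → length y ≤ length (lps w)
  lps-longest [] a y _ e rewrite ++-conicalʳ a y e = z≤n
  lps-longest (c ∷ w) a y pal e with palindrome? (c ∷ w)
  ... | yes _ = subst (λ v → length y ≤ length v) e (length-++-≤ʳ y {a})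
  lps-longest (c ∷ w) [] y pal e | no ¬pal = ⊥-elim (¬pal (subst Palindrome e pal))
  lps-longest (c ∷ w) (_ ∷ a) y pal e | no _ = lps-longest w a y pal (proj₂ (∷-injective e))

  palindrome-suffix-prefix : ∀ (d x P : Word k) → Palindrome x → Palindrome P → d ++ x ≡ P → x ++ reverse d ≡ P
  palindrome-suffix-prefix d x P x-pal P-pal e = begin
    x ++ reverse d          ≡⟨ cong (_++ reverse d) (sym x-pal) ⟩
    reverse x ++ reverse d  ≡⟨ sym (reverse-++ d x) ⟩
    reverse (d ++ x)        ≡⟨ cong reverse e ⟩
    reverse P               ≡⟨ P-pal ⟩
    P                       ∎

  -- A palindromic suffix of w ∷ʳ c is a suffix of its lps, hence the lps itself or,
  -- reflected inside the lps, a factor of w.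
  palindromic-suffix : ∀ a x w c → Palindrome x → a ++ x ≡ w ∷ʳ c → FactorOf x w ⊎ x ≡ lps (w ∷ʳ c)
  palindromic-suffix a x w c pal ax≡ with lps-suffix (w ∷ʳ c)
  ... | a′ , a′L≡ with suffix-of-suffix a x a′ _ (trans ax≡ (sym a′L≡)) (lps-longest (w ∷ʳ c) a x pal ax≡)
  ... | [] , x≡L = inj₂ x≡L
  ... | c′ ∷ d , dx≡L = inj₁ (a′ , reverse d , drop-last a′ x (reverse d) c′ w c (begin
    a′ ++ x ++ (reverse d ∷ʳ c′)  ≡⟨ cong (λ r → a′ ++ x ++ r) (sym (unfold-reverse c′ d)) ⟩
    a′ ++ x ++ reverse (c′ ∷ d)   ≡⟨ cong (a′ ++_) x-reflected ⟩
    a′ ++ lps (w ∷ʳ c)            ≡⟨ a′L≡ ⟩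
    w ∷ʳ c                        ∎))
    where
    x-reflected : x ++ reverse (c′ ∷ d) ≡ lps (w ∷ʳ c)
    x-reflected = palindrome-suffix-prefix (c′ ∷ d) x (lps (w ∷ʳ c)) pal (lps-palindrome (w ∷ʳ c)) dx≡L

  new-palindrome : ∀ x w c → Palindrome x → FactorOf x (w ∷ʳ c) → FactorOf x w ⊎ x ≡ lps (w ∷ʳ c)
  new-palindrome x w c pal (a , b , e) with initLast b
  ... | b′ ∷ʳ′ c′ = inj₁ (a , b′ , drop-last a x b′ c′ w c e)
  ... | [] = palindromic-suffix a x w c pal (trans (cong (a ++_) (sym (++-identityʳ x))) e)

  numPal-snoc : ∀ w c → numPal (w ∷ʳ c) ≤ suc (numPal w)
  numPal-snoc w c = numPal-≤ (w ∷ʳ c) (lps (w ∷ʳ c) ∷ palFactors w) covers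
    where
    covers : ∀ x → Palindrome x → FactorOf x (w ∷ʳ c) → x ∈ lps (w ∷ʳ c) ∷ palFactors w
    covers x pal factor with new-palindrome x w c pal factor
    ... | inj₁ old = there (∈-palFactors w pal old)
    ... | inj₂ x≡lps = here x≡lps

  numPal-snoc-old : ∀ w c → FactorOf (lps (w ∷ʳ c)) w → numPal (w ∷ʳ c) ≤ numPal w
  numPal-snoc-old w c lps-old = numPal-≤ (w ∷ʳ c) (palFactors w) covers
    where
    covers : ∀ x → Palindrome x → FactorOf x (w ∷ʳ c) → x ∈ palFactors w
    covers x pal factor with new-palindrome x w c pal factor
    ... | inj₁ old = ∈-palFactors w pal old
    ... | inj₂ refl = ∈-palFactors w pal lps-old

  length-snoc : ∀ (w : Word k) c → length (w ∷ʳ c) + 1 ≡ suc (length w + 1)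
  length-snoc w c = trans (cong (_+ 1) (length-++ w)) (+-comm (length w + 1) 1)

  numPal-bound : ∀ w → numPal w ≤ length w + 1
  numPal-bound w = bound (reverseView w)
    where
    bound : ∀ {w} → Reverse w → numPal w ≤ length w + 1
    bound [] = ≤-refl
    bound (w ∶ r ∶ʳ c) =
      ≤-trans (numPal-snoc w c) (subst (suc (numPal w) ≤_) (sym (length-snoc w c)) (s≤s (bound r)))

  defect-snoc-≡ : ∀ w c → defect (w ∷ʳ c) ≡ suc (length w + 1) ∸ numPal (w ∷ʳ c)
  defect-snoc-≡ w c = cong (_∸ numPal (w ∷ʳ c)) (length-snoc w c)

  defect-snoc : ∀ w c → defect w ≤ defect (w ∷ʳ c)
  defect-snoc w c rewrite defect-snoc-≡ w c = ∸-monoʳ-≤ (suc (length w + 1)) (numPal-snoc w c)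

  defect-snoc-old : ∀ w c → FactorOf (lps (w ∷ʳ c)) w → defect w < defect (w ∷ʳ c)
  defect-snoc-old w c lps-old rewrite defect-snoc-≡ w c =
    subst (_≤ suc (length w + 1) ∸ numPal (w ∷ʳ c)) (+-∸-assoc 1 (numPal-bound w))
      (∸-monoʳ-≤ (suc (length w + 1)) (numPal-snoc-old w c lps-old))

-- If a segment of length l + o at g ends where a segment of length l at t ends, then g + o = t.
offset-length : ∀ g l o t → g + (l + o) ≡ t + l → g + o ≡ t
offset-length g l o t ends = +-cancelʳ-≡ l (g + o) t (trans (reassociate g l o) ends)
  where
  reassociate : ∀ g l o → g + o + l ≡ g + (l + o)
  reassociate = solve-∀

-- A segment no longer than n and ending where seg s n ends starts at or after s.
suffix-start-≤ : ∀ {s n d l} → l ≤ n → d + l ≡ s + n → s ≤ d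
suffix-start-≤ {s} {n} {d} {l} l≤n ends = +-cancelʳ-≤ l s d (subst (s + l ≤_) (sym ends) (+-monoʳ-≤ s l≤n))

-- A segment of length l ending where a window of length (l + o) + 1 at s ends starts at s + o + 1.
window-start : ∀ l o s d → suc (l + o) + s ≡ d + l → d ≡ s + suc o
window-start l o s d ends = +-cancelʳ-≡ l d (s + suc o) (trans (sym ends) (reassociate l o s))
  where
  reassociate : ∀ l o s → suc (l + o) + s ≡ s + suc o + l
  reassociate = solve-∀

module _ {k : ℕ} (u : InfWord k) where

  private
    seg : ℕ → ℕ → Word k
    seg = segment u

  seg-length : ∀ i n → length (seg i n) ≡ n
  seg-length i zero = refl
  seg-length i (suc n) = cong suc (seg-length (suc i) n)

  seg-++ : ∀ i a b → seg i (a + b) ≡ seg i a ++ seg (i + a) b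
  seg-++ i zero b = cong (λ j → seg j b) (sym (+-identityʳ i))
  seg-++ i (suc a) b =
    cong (u i ∷_) (trans (seg-++ (suc i) a b) (cong (λ j → seg (suc i) a ++ seg j b) (sym (+-suc i a))))

  prefix-snoc : ∀ n → prefix u (suc n) ≡ prefix u n ∷ʳ u n
  prefix-snoc n = trans (cong (seg 0) (+-comm 1 n)) (seg-++ 0 n 1)

  suffix-of-segment : ∀ i n a x → a ++ x ≡ seg i n →
    length a + length x ≡ n × x ≡ seg (i + length a) (length x)
  suffix-of-segment i n a x e =
    ends , proj₂ (++-cancel-length a x (seg i (length a)) (seg (i + length a) (length x))
                   (trans e (trans (cong (seg i) (sym ends)) (seg-++ i (length a) (length x))))
                   (sym (seg-length i (length a))))
    where
    ends : length a + length x ≡ n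
    ends = trans (sym (length-++ a)) (trans (cong length e) (seg-length i n))

  lps-segment : ∀ s n → Σ ℕ λ g → Σ ℕ λ l → g + l ≡ n × lps (seg s n) ≡ seg (s + g) l
  lps-segment s n with lps-suffix (seg s n)
  ... | a , e = length a , _ , suffix-of-segment s n a _ e

  segment-in-prefix : ∀ {n j l} → j + l ≤ n → FactorOf (seg j l) (prefix u n)
  segment-in-prefix {n} {j} {l} fits with m≤n⇒∃[o]m+o≡n fits
  ... | r , refl = seg 0 j , seg (j + l) r , sym (begin
    seg 0 (j + l + r)                  ≡⟨ cong (seg 0) (+-assoc j l r) ⟩
    seg 0 (j + (l + r))                ≡⟨ seg-++ 0 j (l + r) ⟩
    seg 0 j ++ seg j (l + r)           ≡⟨ cong (seg 0 j ++_) (seg-++ j l r) ⟩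
    seg 0 j ++ seg j l ++ seg (j + l) r  ∎)

  factor-of-prefix⇒occurs : ∀ {n x} → FactorOf x (prefix u n) →
    Σ ℕ λ j → j + length x ≤ n × seg j (length x) ≡ x
  factor-of-prefix⇒occurs {n} {x} (a , b , e) with suffix-of-segment 0 n a (x ++ b) e
  ... | ends , x++b≡ = length a , fits , sym (proj₁ (++-cancel-length x b _ _ split (sym (seg-length _ (length x)))))
    where
    fits : length a + length x ≤ n
    fits = subst (length a + length x ≤_) ends (+-monoʳ-≤ (length a) (length-++-≤ˡ x))
    split : x ++ b ≡ seg (length a) (length x) ++ seg (length a + length x) (length b)
    split = trans x++b≡ (trans (cong (seg (length a)) (length-++ x)) (seg-++ (length a) (length x) (length b)))

  palindrome-ends : ∀ d a n {L} → a + n ≡ L → Palindrome (seg d L) → seg d n ≡ reverse (seg (d + a) n)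
  palindrome-ends d a n refl pal =
    sym (proj₁ (++-cancel-length (reverse (seg (d + a) n)) (reverse (seg d a)) (seg d n) (seg (d + n) a)
                  halves same-length))
    where
    halves : reverse (seg (d + a) n) ++ reverse (seg d a) ≡ seg d n ++ seg (d + n) a
    halves = begin
      reverse (seg (d + a) n) ++ reverse (seg d a)  ≡⟨ sym (reverse-++ (seg d a) (seg (d + a) n)) ⟩
      reverse (seg d a ++ seg (d + a) n)            ≡⟨ cong reverse (sym (seg-++ d a n)) ⟩
      reverse (seg d (a + n))                       ≡⟨ pal ⟩
      seg d (a + n)                                 ≡⟨ cong (seg d) (+-comm a n) ⟩
      seg d (n + a)                                 ≡⟨ seg-++ d n a ⟩
      seg d n ++ seg (d + n) a                      ∎
    same-length : length (reverse (seg (d + a) n)) ≡ length (seg d n)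
    same-length = trans (length-reverse (seg (d + a) n)) (trans (seg-length (d + a) n) (sym (seg-length d n)))

  FirstOcc : ℕ → ℕ → Set
  FirstOcc d l = ∀ j → j < d → seg j l ≢ seg d l

  first-occurrence : ∀ {i l z} → seg i l ≡ z → Σ ℕ λ d → seg d l ≡ z × FirstOcc d l
  first-occurrence {i} {l} {z} occ = d , d-occ , λ j j<d j-occ → <⇒≱ j<d (least-minimal occ? (suc i) (trans j-occ d-occ))
    where
    occ? : ∀ j → Dec (seg j l ≡ z)
    occ? j = seg j l ≟w z
    d : ℕ
    d = least occ? (suc i)
    d-occ : seg d l ≡ z
    d-occ = least-sound occ? (suc i) occ (n<1+n i)

  first-occ-end : ∀ {d₁ l₁ d₂ l₂} → FirstOcc d₁ l₁ → FirstOcc d₂ l₂ →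
    seg d₁ l₁ ≡ seg d₂ l₂ → d₁ + l₁ ≡ d₂ + l₂
  first-occ-end {d₁} {l₁} {d₂} {l₂} first₁ first₂ e
    with trans (sym (seg-length d₁ l₁)) (trans (cong length e) (seg-length d₂ l₂))
  ... | refl with <-cmp d₁ d₂
  ...   | tri< d₁<d₂ _ _ = ⊥-elim (first₂ d₁ d₁<d₂ e)
  ...   | tri≈ _ d₁≡d₂ _ = cong (_+ l₁) d₁≡d₂
  ...   | tri> _ _ d₂<d₁ = ⊥-elim (first₁ d₂ d₂<d₁ (sym e))

  first-occ-not-in-prefix : ∀ {n d l} → FirstOcc d l → n < d + l → ¬ FactorOf (seg d l) (prefix u n)
  first-occ-not-in-prefix {n} {d} {l} first late factor with factor-of-prefix⇒occurs factor
  ... | j , fits , occ = first j (+-cancelʳ-< l j d (≤-<-trans fits′ late)) occ′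
    where
    fits′ : j + l ≤ n
    fits′ = subst (λ m → j + m ≤ n) (seg-length d l) fits
    occ′ : seg j l ≡ seg d l
    occ′ = subst (λ m → seg j m ≡ seg d l) (seg-length d l) occ

  -- A palindrome occurring first at p cannot be a proper suffix of a palindrome:
  -- its mirror image would be an earlier occurrence.
  first-palindrome-not-proper-suffix : ∀ d o l p → d + suc o ≡ p → Palindrome (seg p l) → FirstOcc p l →
    ¬ Palindrome (seg d (suc o + l))
  first-palindrome-not-proper-suffix d o l p refl pal first outer-pal =
    first d (m<m+n d (s≤s z≤n)) (trans (palindrome-ends d (suc o) l refl outer-pal) pal)

  defect-prefix-step : ∀ n → defect (prefix u n) ≤ defect (prefix u (suc n))
  defect-prefix-step n =
    subst (λ v → defect (prefix u n) ≤ defect v) (sym (prefix-snoc n)) (defect-snoc (prefix u n) (u n))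

  defect-prefix-mono : ∀ {m n} → m ≤ n → defect (prefix u m) ≤ defect (prefix u n)
  defect-prefix-mono {n = zero} z≤n = ≤-refl
  defect-prefix-mono {m} {suc n} m≤1+n with m≤n⇒m<n∨m≡n m≤1+n
  ... | inj₁ m<1+n = ≤-trans (defect-prefix-mono (≤-pred m<1+n)) (defect-prefix-step n)
  ... | inj₂ refl = ≤-refl

  lps-prefix-new : ∀ N → (∀ n → defect (prefix u n) ≤ defect (prefix u N)) →
    ∀ n → N ≤ n → ¬ FactorOf (lps (prefix u (suc n))) (prefix u n)
  lps-prefix-new N maximal n N≤n old = <⇒≱ grows (≤-trans (maximal (suc n)) (defect-prefix-mono N≤n))
    where
    grows : defect (prefix u n) < defect (prefix u (suc n))
    grows = subst (λ v → defect (prefix u n) < defect v) (sym (prefix-snoc n))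
              (defect-snoc-old (prefix u n) (u n) (subst (λ v → FactorOf (lps v) (prefix u n)) (prefix-snoc n) old))

  RichAfter : ℕ → Set
  RichAfter N = ∀ e → N < e → Σ ℕ λ d → Σ ℕ λ l → d + l ≡ e × Palindrome (seg d l) × FirstOcc d l

  rich-after : ∀ N → (∀ n → defect (prefix u n) ≤ defect (prefix u N)) → RichAfter N
  rich-after N maximal (suc n) (s≤s N≤n) with lps-segment 0 (suc n)
  ... | d , l , ends , lps≡ = d , l , ends , subst Palindrome lps≡ (lps-palindrome (prefix u (suc n))) , first
    where
    first : FirstOcc d l
    first j j<d occ = lps-prefix-new N maximal n N≤n
      (subst (λ x → FactorOf x (prefix u n)) (trans occ (sym lps≡))
        (segment-in-prefix (≤-pred (subst (suc (j + l) ≤_) ends (+-monoˡ-< l j<d)))))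

  lps-segment-longest : ∀ s t l {g l′} → Palindrome (seg (s + t) l) →
    lps (seg s (t + l)) ≡ seg (s + g) l′ → l ≤ l′
  lps-segment-longest s t l {g} {l′} pal lps≡ =
    subst₂ _≤_ (seg-length (s + t) l) (trans (cong length lps≡) (seg-length (s + g) l′))
      (lps-longest (seg s (t + l)) (seg s t) (seg (s + t) l) pal (sym (seg-++ s t l)))

  lps-window : ∀ s t l → Palindrome (seg (s + t) l) → FirstOcc (s + t) l →
    lps (seg s (t + l)) ≡ seg (s + t) l
  lps-window s t l pal first with lps-segment s (t + l)
  ... | g , l′ , ends , lps≡ with m≤n⇒∃[o]m+o≡n (lps-segment-longest s t l pal lps≡)
  ... | zero , refl =
    trans lps≡ (cong₂ seg (cong (s +_) (trans (sym (+-identityʳ g)) (offset-length g l 0 t ends))) (+-identityʳ l))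
  ... | suc o , refl = ⊥-elim (first-palindrome-not-proper-suffix (s + g) o l (s + t) ends′ pal first outer-pal)
    where
    ends′ : s + g + suc o ≡ s + t
    ends′ = trans (+-assoc s g (suc o)) (cong (s +_) (offset-length g l (suc o) t ends))
    outer-pal : Palindrome (seg (s + g) (suc o + l))
    outer-pal = subst Palindrome (trans lps≡ (cong (seg (s + g)) (+-comm l (suc o)))) (lps-palindrome (seg s (t + l)))

  lps-window-at : ∀ s n d l → s ≤ d → d + l ≡ s + n → Palindrome (seg d l) → FirstOcc d l →
    lps (seg s n) ≡ seg d l
  lps-window-at s n d l s≤d ends pal first with m≤n⇒∃[o]m+o≡n s≤d
  ... | t , refl with +-cancelˡ-≡ s (t + l) n (trans (sym (+-assoc s t l)) ends)
  ... | refl = lps-window s t l pal first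

  record ShortNewLps (N s : ℕ) : Set where
    field
      start len : ℕ
      short : len < suc N
      ends : start + len ≡ s + suc N
      is-lps : lps (seg s (suc N)) ≡ seg start len
      new : FirstOcc start len

  long-palindrome-mirror : ∀ s n d l → n ≤ l → d + l ≡ s + n → Palindrome (seg d l) →
    d ≤ s × seg d n ≡ reverse (seg s n)
  long-palindrome-mirror s n d l n≤l ends pal with m≤n⇒∃[o]m+o≡n n≤l
  ... | a , refl with offset-length d n a s ends
  ... | refl = m≤m+n d a , palindrome-ends d a n (+-comm a n) pal

  window-lps : ∀ {N} → RichAfter N → ∀ s → ¬ Palindrome (seg s (suc N)) →
    (∀ j → j < s → seg j (suc N) ≢ reverse (seg s (suc N))) → ShortNewLps N s
  window-lps {N} rich s nonpal no-reverse-before with rich (s + suc N) (m≤n+m (suc N) s)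
  ... | d , l , ends , pal , first with l <? suc N
  ... | yes short = record
    { start = d ; len = l ; short = short ; ends = ends ; new = first
    ; is-lps = lps-window-at s (suc N) d l (suffix-start-≤ (<⇒≤ short) ends) ends pal first }
  ... | no long with long-palindrome-mirror s (suc N) d l (≮⇒≥ long) ends pal
  ...   | d≤s , mirror with m≤n⇒m<n∨m≡n d≤s
  ...     | inj₁ d<s = ⊥-elim (no-reverse-before d d<s mirror)
  ...     | inj₂ refl = ⊥-elim (nonpal (sym mirror))

  reverse-window : ∀ s t l → Palindrome (seg (s + t) l) → reverse (seg s (t + l)) ≡ seg (s + t) l ++ reverse (seg s t)
  reverse-window s t l pal = begin
    reverse (seg s (t + l))                    ≡⟨ cong reverse (seg-++ s t l) ⟩
    reverse (seg s t ++ seg (s + t) l)         ≡⟨ reverse-++ (seg s t) (seg (s + t) l) ⟩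
    reverse (seg (s + t) l) ++ reverse (seg s t) ≡⟨ cong (_++ reverse (seg s t)) pal ⟩
    seg (s + t) l ++ reverse (seg s t)         ∎

  window-from-palindrome : ∀ {N d l} → Palindrome (seg d l) → FirstOcc d l → l < suc N → N < d + l →
    Σ ℕ λ s → ¬ Palindrome (seg s (suc N)) × (∀ j → j ≤ s → seg j (suc N) ≢ reverse (seg s (suc N))) ×
              lps (seg s (suc N)) ≡ seg d l
  window-from-palindrome {N} {d} {l} pal first short late with m≤n⇒∃[o]m+o≡n short
  ... | o , refl with m≤n⇒∃[o]m+o≡n late
  ... | s , ends with window-start l o s d ends
  ... | refl = s , nonpal , no-reverse , trans (cong (λ n → lps (seg s n)) H≡) (lps-window s (suc o) l pal first)
    where
    H≡ : suc (l + o) ≡ suc o + l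
    H≡ = cong suc (+-comm l o)
    nonpal : ¬ Palindrome (seg s (suc (l + o)))
    nonpal p = first-palindrome-not-proper-suffix s o l (s + suc o) refl pal first (subst (λ n → Palindrome (seg s n)) H≡ p)
    no-reverse : ∀ j → j ≤ s → seg j (suc (l + o)) ≢ reverse (seg s (suc (l + o)))
    no-reverse j j≤s e = first j (≤-<-trans j≤s (m<m+n s (s≤s z≤n)))
      (proj₁ (++-cancel-length (seg j l) (seg (j + l) (suc o)) (seg (s + suc o) l) (reverse (seg s (suc o))) split
                (trans (seg-length j l) (sym (seg-length (s + suc o) l)))))
      where
      split : seg j l ++ seg (j + l) (suc o) ≡ seg (s + suc o) l ++ reverse (seg s (suc o))
      split = begin
        seg j l ++ seg (j + l) (suc o)             ≡⟨ sym (seg-++ j l (suc o)) ⟩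
        seg j (l + suc o)                          ≡⟨ cong (seg j) (+-suc l o) ⟩
        seg j (suc (l + o))                        ≡⟨ e ⟩
        reverse (seg s (suc (l + o)))              ≡⟨ cong (λ n → reverse (seg s n)) H≡ ⟩
        reverse (seg s (suc o + l))                ≡⟨ reverse-window s (suc o) l pal ⟩
        seg (s + suc o) l ++ reverse (seg s (suc o)) ∎

  occurrence-bound : ∀ n (ws : List (Word k)) → (∀ {w} → w ∈ ws → ∃ λ i → seg i n ≡ w) →
    ∃ λ B → ∀ {w} → w ∈ ws → ∃ λ i → i ≤ B × seg i n ≡ w
  occurrence-bound n [] _ = 0 , λ ()
  occurrence-bound n (w ∷ ws) occurs with occurs (here refl) | occurrence-bound n ws (λ w∈ → occurs (there w∈))
  ... | i , occ | B , bounded = i ⊔ B , bounded′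
    where
    bounded′ : ∀ {v} → v ∈ w ∷ ws → ∃ λ j → j ≤ i ⊔ B × seg j n ≡ v
    bounded′ (here refl) = i , m≤m⊔n i B , occ
    bounded′ (there v∈) with bounded v∈
    ... | j , j≤B , occ′ = j , ≤-trans j≤B (m≤n⊔m i B) , occ′

  module Counting (closed : ClosedUnderReversal u) (N : ℕ) (rich : RichAfter N)
                  (xs : List (Word k)) (xs-unique : Unique xs)
                  (xs-enum : ∀ w → w ∈ xs ⇔ (length w ≡ suc N × Factor u w)) where

    open ShortNewLps

    window-∈ : ∀ s → seg s (suc N) ∈ xs
    window-∈ s = from (xs-enum (seg s (suc N))) (seg-length s (suc N) , s , cong (seg s) (seg-length s (suc N)))

    ∈-window : ∀ {w} → w ∈ xs → ∃ λ i → seg i (suc N) ≡ w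
    ∈-window {w} w∈ with to (xs-enum w) w∈
    ... | len , i , occ = i , subst (λ n → seg i n ≡ w) len occ

    reverse-∈ : ∀ {w} → w ∈ xs → reverse w ∈ xs
    reverse-∈ {w} w∈ with to (xs-enum w) w∈
    ... | len , factor = from (xs-enum (reverse w)) (trans (length-reverse w) len , closed w factor)

    firstPos : Word k → ℕ
    firstPos w = least (λ j → seg j (suc N) ≟w w) (suc (proj₁ (occurrence-bound (suc N) xs ∈-window)))

    firstPos-occ : ∀ {w} → w ∈ xs → seg (firstPos w) (suc N) ≡ w
    firstPos-occ {w} w∈ with proj₂ (occurrence-bound (suc N) xs ∈-window) w∈
    ... | i , i≤B , occ = least-sound (λ j → seg j (suc N) ≟w w) _ occ (s≤s i≤B)

    firstPos-minimal : ∀ {w j} → seg j (suc N) ≡ w → firstPos w ≤ j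
    firstPos-minimal {w} occ = least-minimal (λ j → seg j (suc N) ≟w w) _ occ

    earlier? : ∀ w → Dec (firstPos w < firstPos (reverse w))
    earlier? w = firstPos w <? firstPos (reverse w)

    pals nonpals earlier later : List (Word k)
    pals = filter palindrome? xs
    nonpals = filter (¬? ∘ palindrome?) xs
    earlier = filter earlier? nonpals
    later = filter (¬? ∘ earlier?) nonpals

    earlier-unique : Unique earlier
    earlier-unique = Unique.filter⁺ earlier? (Unique.filter⁺ (¬? ∘ palindrome?) xs-unique)

    later-unique : Unique later
    later-unique = Unique.filter⁺ (¬? ∘ earlier?) (Unique.filter⁺ (¬? ∘ palindrome?) xs-unique)

    ∈-earlier⁻ : ∀ {w} → w ∈ earlier → w ∈ xs × ¬ Palindrome w × firstPos w < firstPos (reverse w)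
    ∈-earlier⁻ w∈ with ∈-filter⁻ earlier? w∈
    ... | w∈nonpals , before = Product.map₂ (_, before) (∈-filter⁻ (¬? ∘ palindrome?) w∈nonpals)

    ∈-earlier⁺ : ∀ {w} → w ∈ xs → ¬ Palindrome w → firstPos w < firstPos (reverse w) → w ∈ earlier
    ∈-earlier⁺ w∈ nonpal before = ∈-filter⁺ earlier? (∈-filter⁺ (¬? ∘ palindrome?) w∈ nonpal) before

    ∈-later⁻ : ∀ {w} → w ∈ later → w ∈ xs × ¬ Palindrome w × ¬ firstPos w < firstPos (reverse w)
    ∈-later⁻ w∈ with ∈-filter⁻ (¬? ∘ earlier?) w∈
    ... | w∈nonpals , not-before = Product.map₂ (_, not-before) (∈-filter⁻ (¬? ∘ palindrome?) w∈nonpals)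

    ∈-later⁺ : ∀ {w} → w ∈ xs → ¬ Palindrome w → ¬ firstPos w < firstPos (reverse w) → w ∈ later
    ∈-later⁺ w∈ nonpal not-before = ∈-filter⁺ (¬? ∘ earlier?) (∈-filter⁺ (¬? ∘ palindrome?) w∈ nonpal) not-before

    length-split : length xs ≡ length pals + (length earlier + length later)
    length-split = trans (length-filter-split palindrome? xs) (cong (length pals +_) (length-filter-split earlier? nonpals))

    pals-count : ∀ {p} → HasCard (λ w → length w ≡ suc N × Factor u w × Palindrome w) p → length pals ≡ p
    pals-count card = card-length card (Unique.filter⁺ palindrome? xs-unique) (λ w → mk⇔ (pals⇒ w) (⇒pals w))
      where
      pals⇒ : ∀ w → w ∈ pals → length w ≡ suc N × Factor u w × Palindrome w
      pals⇒ w w∈ with ∈-filter⁻ palindrome? w∈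
      ... | w∈xs , pal = Product.map₂ (_, pal) (to (xs-enum w) w∈xs)
      ⇒pals : ∀ w → length w ≡ suc N × Factor u w × Palindrome w → w ∈ pals
      ⇒pals w (len , factor , pal) = ∈-filter⁺ palindrome? (from (xs-enum w) (len , factor)) pal

    -- Reversal maps the earlier windows bijectively onto the later ones.
    later-count : length later ≡ length earlier
    later-count =
      trans (same-members⇒same-length later-unique (Unique.map⁺ reverse-injective earlier-unique) later⊆ ⊆later)
            (length-map reverse earlier)
      where
      later⊆ : later ⊆ map reverse earlier
      later⊆ {w} w∈ with ∈-later⁻ w∈
      ... | w∈xs , nonpal , not-before =
        subst (_∈ map reverse earlier) (reverse-involutive w) (∈-map⁺ reverse
          (∈-earlier⁺ (reverse-∈ w∈xs) (nonpalindrome-reverse nonpal)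
            (subst (λ v → firstPos (reverse w) < firstPos v) (sym (reverse-involutive w))
              (≤∧≢⇒< (≮⇒≥ not-before) distinct))))
        where
        distinct : firstPos (reverse w) ≢ firstPos w
        distinct same = nonpal (begin
          reverse w                          ≡⟨ sym (firstPos-occ (reverse-∈ w∈xs)) ⟩
          seg (firstPos (reverse w)) (suc N) ≡⟨ cong (λ i → seg i (suc N)) same ⟩
          seg (firstPos w) (suc N)           ≡⟨ firstPos-occ w∈xs ⟩
          w                                  ∎)
      ⊆later : map reverse earlier ⊆ later
      ⊆later y∈ with ∈-map⁻ reverse y∈
      ... | w , w∈ , refl with ∈-earlier⁻ w∈
      ...   | w∈xs , nonpal , before =
        ∈-later⁺ (reverse-∈ w∈xs) (nonpalindrome-reverse nonpal)
          (subst (λ v → ¬ firstPos (reverse w) < firstPos v) (sym (reverse-involutive w)) (<-asym before))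

    ShortNew : Word k → Set
    ShortNew x = Factor u x × Palindrome x × length x < suc N × ¬ FactorOf x (prefix u N)

    segment-short-new : ∀ {d l} → Palindrome (seg d l) → FirstOcc d l → l < suc N → N < d + l → ShortNew (seg d l)
    segment-short-new {d} {l} pal first short late =
      (d , cong (seg d) (seg-length d l)) , pal , subst (_< suc N) (sym (seg-length d l)) short ,
      first-occ-not-in-prefix first late

    earlier-lps : ∀ {w} → w ∈ earlier → ShortNewLps N (firstPos w)
    earlier-lps {w} w∈ with ∈-earlier⁻ w∈
    ... | w∈xs , nonpal , before =
      window-lps rich (firstPos w) (nonpal ∘ subst Palindrome (firstPos-occ w∈xs)) no-reverse-before
      where
      no-reverse-before : ∀ j → j < firstPos w → seg j (suc N) ≢ reverse (seg (firstPos w) (suc N))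
      no-reverse-before j j<first occ =
        <⇒≱ (<-trans j<first before) (firstPos-minimal (trans occ (cong reverse (firstPos-occ w∈xs))))

    lps-earlier : ∀ {w} (w∈ : w ∈ earlier) → lps w ≡ seg (start (earlier-lps w∈)) (len (earlier-lps w∈))
    lps-earlier w∈ = trans (cong lps (sym (firstPos-occ (proj₁ (∈-earlier⁻ w∈))))) (is-lps (earlier-lps w∈))

    -- The lps maps the earlier windows bijectively onto the ShortNew palindromes.
    earlier-short-new : ∀ {w} → w ∈ earlier → ShortNew (lps w)
    earlier-short-new {w} w∈ =
      subst ShortNew (sym (lps-earlier w∈))
        (segment-short-new (subst Palindrome (lps-earlier w∈) (lps-palindrome w)) (new r) (short r)
          (subst (N <_) (sym (ends r)) (m≤n+m (suc N) (firstPos w))))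
      where
      r : ShortNewLps N (firstPos w)
      r = earlier-lps w∈

    lps-injective : ∀ {x y} → x ∈ earlier → y ∈ earlier → lps x ≡ lps y → x ≡ y
    lps-injective {x} {y} x∈ y∈ e = begin
      x                         ≡⟨ sym (firstPos-occ (proj₁ (∈-earlier⁻ x∈))) ⟩
      seg (firstPos x) (suc N)  ≡⟨ cong (λ i → seg i (suc N)) same-start ⟩
      seg (firstPos y) (suc N)  ≡⟨ firstPos-occ (proj₁ (∈-earlier⁻ y∈)) ⟩
      y                         ∎
      where
      rx = earlier-lps x∈
      ry = earlier-lps y∈
      same-start : firstPos x ≡ firstPos y
      same-start = +-cancelʳ-≡ (suc N) (firstPos x) (firstPos y) (begin
        firstPos x + suc N  ≡⟨ sym (ends rx) ⟩
        start rx + len rx   ≡⟨ first-occ-end (new rx) (new ry) (trans (sym (lps-earlier x∈)) (trans e (lps-earlier y∈))) ⟩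
        start ry + len ry   ≡⟨ ends ry ⟩
        firstPos y + suc N  ∎)

    short-new-in-image : ∀ {z} → ShortNew z → z ∈ map lps earlier
    short-new-in-image {z} ((i , occ) , pal , short , fresh) with first-occurrence occ
    ... | d , d-occ , first-d
      with window-from-palindrome (subst Palindrome (sym d-occ) pal) first-d short
             (≰⇒> (λ fits → fresh (subst (λ x → FactorOf x (prefix u N)) d-occ (segment-in-prefix fits))))
    ...   | s , nonpal , no-reverse , lps≡ =
      subst (_∈ map lps earlier) (trans lps≡ d-occ) (∈-map⁺ lps (∈-earlier⁺ (window-∈ s) nonpal
        (≤-<-trans (firstPos-minimal refl)
          (≰⇒> (λ le → no-reverse _ le (firstPos-occ (reverse-∈ (window-∈ s))))))))

    earlier-count : ∀ {m} → HasCard ShortNew m → length earlier ≡ m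
    earlier-count card =
      trans (sym (length-map lps earlier))
            (card-length card (map-unique lps earlier-unique lps-injective) (λ z → mk⇔ image⇒ short-new-in-image))
      where
      image⇒ : ∀ {z} → z ∈ map lps earlier → ShortNew z
      image⇒ z∈ with ∈-map⁻ lps z∈
      ... | w , w∈ , refl = earlier-short-new w∈

lemma9 : ∀ {k : ℕ} (u : InfWord k) → ClosedUnderReversal u →
         (N : ℕ) → (∀ n → defect (prefix u n) ≤ defect (prefix u N)) →
         (c p m : ℕ) →
         HasCard (λ w → length w ≡ suc N × Factor u w) c →
         HasCard (λ w → length w ≡ suc N × Factor u w × Palindrome w) p →
         HasCard (λ x → Factor u x × Palindrome x × length x < suc N × ¬ FactorOf x (prefix u N)) m →
         c ≡ p + 2 * m
lemma9 u closed N maximal c p m (xs , xs-unique , xs-enum , refl) pal-card short-new-card = begin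
  length xs                                        ≡⟨ length-split ⟩
  length pals + (length earlier + length later)    ≡⟨ cong (λ b → length pals + (length earlier + b)) later-count ⟩
  length pals + (length earlier + length earlier)  ≡⟨ cong₂ (λ a b → a + (b + b)) (pals-count pal-card) (earlier-count short-new-card) ⟩
  p + (m + m)                                      ≡⟨ cong (λ b → p + (m + b)) (sym (+-identityʳ m)) ⟩
  p + 2 * m                                        ∎
  where open Counting u closed N (rich-after u N maximal) xs xs-unique xs-enum
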